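{- Let $n\ge1$ and let $CR_n$ be the crown graph with vertex set $A_n\cup A'_n$, $A_n=\{v_1,\dots,v_n\}$, $A'_n=\{v'_1,\dots,v'_n\}$, where $v_i$ is adjacent to $v'_j$ if and only if $i\ne j$ (and no other edges). Let $\mathcal{V}$ be a partition of $V(CR_n)$ and $<$ an ordering of $V(CR_n)$ consistent with $\mathcal{V}$. Then the number of classes of $\mathcal{V}$ containing a little vertex is at least $n-1$; in other words, at most one class contains two little vertices, and such a class contains one little vertex of $A_n$ and one of $A'_n$.
   Context: For $v_i$ set $\mathrm{mirror}(v_i)=v'_i$ and for $v'_i$ set $\mathrm{mirror}(v'_i)=v_i$. A vertex $v$ is little (with respect to $<$) if $v<\mathrm{mirror}(v)$. An ordering $<$ is consistent with a partition $\mathcal{V}$ of $V(G)$ if for every triple $p<q<r$ with $p,q$ in the same class and $pr\in E(G)$, also $qr\in E(G)$. -}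

module Defs where

open import Data.Bool using (Bool; true; false; not)
open import Data.Nat using (ℕ; _∸_)
open import Data.Fin using (Fin)
open import Data.Product using (_×_; _,_; Σ; ∃)
open import Relation.Binary.PropositionalEquality using (_≡_; _≢_)
open import Relation.Binary.Structures using (IsStrictTotalOrder)
open import Function.Definitions using (Injective)

-- Vertices of the crown graph CR_n: (true , i) is v_i ∈ A_n, (false , i) is v'_i ∈ A'_n.
CrownV : ℕ → Set
CrownV n = Bool × Fin n

CrownAdj : ∀ {n} → CrownV n → CrownV n → Set
CrownAdj (b , i) (c , j) = (b ≢ c) × (i ≢ j)

mirror : ∀ {n} → CrownV n → CrownV n
mirror (b , i) = (not b , i)

Little : ∀ {n} → (CrownV n → CrownV n → Set) → CrownV n → Set
Little _≺_ v = v ≺ mirror v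

-- A partition of V is given by a class-assignment map cls : V → C (classes = fibres).
Consistent : ∀ {n} {C : Set} → (CrownV n → C) → (CrownV n → CrownV n → Set) → Set
Consistent {n} cls _≺_ = ∀ (p q r : CrownV n) → p ≺ q → q ≺ r → cls p ≡ cls q
  → CrownAdj p r → CrownAdj q r

AtLeastClassesWithLittle : ∀ {n} {C : Set} → (CrownV n → C) → (CrownV n → CrownV n → Set) → ℕ → Set
AtLeastClassesWithLittle {n} {C} cls _≺_ k =
  Σ (Fin k → C) λ g → Injective _≡_ _≡_ g
    × (∀ j → ∃ λ (v : CrownV n) → Little _≺_ v × cls v ≡ g j)

-- Pick one little vertex ℓ i from each twin pair {v_i , v'_i}. If two little vertices u ≺ w
-- share a class, consistency forces them onto opposite sides and then puts every neighbour of u,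
-- hence every little vertex, weakly below w: w is the ≺-largest little vertex. So apart from
-- the largest of the ℓ i, the ℓ i lie in pairwise distinct classes, giving n - 1 classes.
module Submission where

open import Defs
open import Level using (Level)
open import Data.Bool using (true; false) renaming (_≟_ to _≟ᵇ_)
open import Data.Bool.Properties using (not-¬; ¬-not)
open import Data.Nat using (ℕ; _≤_; _∸_; suc; s≤s; z≤n)
open import Data.Fin using (Fin; zero; suc; punchIn) renaming (_≟_ to _≟ᶠ_)
open import Data.Fin.Properties using (punchIn-injective; punchInᵢ≢i)
open import Data.Product using (_×_; _,_; proj₁; proj₂; ∃)
open import Data.Sum using (inj₁; inj₂)
open import Data.Empty using (⊥; ⊥-elim)
open import Relation.Nullary using (yes; no)
open import Relation.Binary.Core using (Rel)
open import Relation.Binary.Definitions using (tri<; tri≈; tri>)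
open import Relation.Binary.PropositionalEquality using (_≡_; _≢_; refl; sym; trans; cong; ≢-sym)
open import Relation.Binary.Structures using (IsStrictTotalOrder)
import Relation.Binary.Construct.StrictToNonStrict as StrictToNonStrict

module _ {a r : Level} {A : Set a} {_<_ : Rel A r} (sto : IsStrictTotalOrder _≡_ _<_) where
  open IsStrictTotalOrder sto renaming (trans to <-trans)
  open StrictToNonStrict _≡_ _<_ using (<⇒≤; reflexive) renaming (_≤_ to _≼_)

  argmax : ∀ {k} (f : Fin (suc k) → A) → ∃ λ d → ∀ i → f i ≼ f d
  argmax {ℕ.zero} f = zero , λ { zero → reflexive refl }
  argmax {suc k} f with argmax (λ i → f (suc i))
  ... | d , f∘suc≼ with compare (f zero) (f (suc d))
  ... | tri< f0<fd _ _ = suc d , λ { zero → <⇒≤ f0<fd ; (suc i) → f∘suc≼ i }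
  ... | tri≈ _ f0≡fd _ = suc d , λ { zero → reflexive f0≡fd ; (suc i) → f∘suc≼ i }
  ... | tri> _ _ fd<f0 = zero , λ { zero → reflexive refl ; (suc i) → <⇒≤ (below-f0 (f∘suc≼ i)) }
    where
    below-f0 : ∀ {x} → x ≼ f (suc d) → x < f zero
    below-f0 (inj₁ x<fd) = <-trans x<fd fd<f0
    below-f0 (inj₂ refl) = fd<f0

module CrownOrder {n : ℕ} {C : Set} (cls : CrownV n → C)
  {_≺_ : CrownV n → CrownV n → Set} (sto : IsStrictTotalOrder _≡_ _≺_)
  (consistent : Consistent cls _≺_) where
  open IsStrictTotalOrder sto renaming (trans to ≺-trans)
  open StrictToNonStrict _≡_ _≺_ using (<⇒≤; reflexive; antisym; <-≤-trans) renaming (_≤_ to _≼_)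

  Little≺ : CrownV n → Set
  Little≺ = Little _≺_

  ≼-antisym : ∀ {x y} → x ≼ y → y ≼ x → x ≡ y
  ≼-antisym = antisym isEquivalence ≺-trans irrefl

  ¬little-opposite-twins : ∀ {b c i} → b ≢ c → Little≺ (b , i) → Little≺ (c , i) → ⊥
  ¬little-opposite-twins {true}  {false} _ l l′ = asym l l′
  ¬little-opposite-twins {false} {true}  _ l l′ = asym l l′
  ¬little-opposite-twins {true}  {true}  b≢c = ⊥-elim (b≢c refl)
  ¬little-opposite-twins {false} {false} b≢c = ⊥-elim (b≢c refl)

  -- Consistency applied to (u , w , mirror w) would make w adjacent to its own mirror.
  same-side-below-little : ∀ {u w} → u ≺ w → Little≺ w → cls u ≡ cls w
                         → proj₁ u ≡ proj₁ w → u ≡ w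
  same-side-below-little {b , i} {.b , j} u≺w lw cuw refl with i ≟ᶠ j
  ... | yes refl = refl
  ... | no i≢j = ⊥-elim (proj₂ (consistent _ _ _ u≺w lw cuw (not-¬ refl , i≢j)) refl)

  littles-of-a-class-on-opposite-sides :
    ∀ (u w : CrownV n) → Little≺ u → Little≺ w → u ≢ w → cls u ≡ cls w → proj₁ u ≢ proj₁ w
  littles-of-a-class-on-opposite-sides u w lu lw u≢w cuw side with compare u w
  ... | tri< u≺w _ _ = u≢w (same-side-below-little u≺w lw cuw side)
  ... | tri≈ _ u≡w _ = u≢w u≡w
  ... | tri> _ _ w≺u = u≢w (sym (same-side-below-little w≺u lu (sym cuw) (sym side)))

  -- If w ≺ r, consistency would make w adjacent to r, yet both lie on the side opposite to u.
  neighbours-below : ∀ {u w r} → u ≺ w → cls u ≡ cls w → proj₁ u ≢ proj₁ w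
                   → CrownAdj u r → r ≼ w
  neighbours-below {u} {w} {r} u≺w cuw uw ur with compare r w
  ... | tri< r≺w _ _ = <⇒≤ r≺w
  ... | tri≈ _ r≡w _ = reflexive r≡w
  ... | tri> _ _ w≺r = ⊥-elim (proj₁ (consistent u w r u≺w w≺r cuw ur) same-side)
    where
    same-side : proj₁ w ≡ proj₁ r
    same-side = trans (¬-not (≢-sym uw)) (sym (¬-not (≢-sym (proj₁ ur))))

  -- A little z ≠ u cannot be mirror u, so z or its mirror (which lies above z) is a neighbour of u.
  littles-below-bound-of-neighbourhood : ∀ {u w} → Little≺ u → u ≺ w
    → (∀ {r} → CrownAdj u r → r ≼ w) → ∀ {z} → Little≺ z → z ≼ w
  littles-below-bound-of-neighbourhood {b , i} lu u≺w below {c , k} lz with c ≟ᵇ b | k ≟ᶠ i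
  ... | yes refl | yes refl = <⇒≤ u≺w
  ... | no c≢b   | yes refl = ⊥-elim (¬little-opposite-twins c≢b lz lu)
  ... | no c≢b   | no k≢i   = below (≢-sym c≢b , ≢-sym k≢i)
  ... | yes refl | no k≢i   = <⇒≤ (<-≤-trans ≺-trans <-respʳ-≈ lz (below (not-¬ refl , ≢-sym k≢i)))

  littles-below : ∀ {u w} → Little≺ u → Little≺ w → cls u ≡ cls w → u ≺ w
                → ∀ {z} → Little≺ z → z ≼ w
  littles-below lu lw cuw u≺w = littles-below-bound-of-neighbourhood lu u≺w
    (neighbours-below u≺w cuw
      (littles-of-a-class-on-opposite-sides _ _ lu lw (λ u≡w → irrefl u≡w u≺w) cuw))

  little-at : (i : Fin n) → ∃ λ v → Little≺ v × proj₂ v ≡ i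
  little-at i with compare (true , i) (false , i)
  ... | tri< v≺v′ _ _ = (true , i) , v≺v′ , refl
  ... | tri≈ _ () _
  ... | tri> _ _ v′≺v = (false , i) , v′≺v , refl

  ℓ : Fin n → CrownV n
  ℓ i = proj₁ (little-at i)

  ℓ-little : ∀ i → Little≺ (ℓ i)
  ℓ-little i = proj₁ (proj₂ (little-at i))

  ℓ-injective : ∀ {i j} → ℓ i ≡ ℓ j → i ≡ j
  ℓ-injective {i} {j} ℓi≡ℓj =
    trans (sym (proj₂ (proj₂ (little-at i)))) (trans (cong proj₂ ℓi≡ℓj) (proj₂ (proj₂ (little-at j))))

  cls∘ℓ-injective-off-max : ∀ {d} → (∀ i → ℓ i ≼ ℓ d)
                          → ∀ {a b} → a ≢ d → b ≢ d → cls (ℓ a) ≡ cls (ℓ b) → a ≡ b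
  cls∘ℓ-injective-off-max {d} ℓ≼ℓd {a} {b} a≢d b≢d c≡ with compare (ℓ a) (ℓ b)
  ... | tri< ℓa≺ℓb _ _ = ⊥-elim (b≢d (ℓ-injective (≼-antisym (ℓ≼ℓd b)
          (littles-below (ℓ-little a) (ℓ-little b) c≡ ℓa≺ℓb (ℓ-little d)))))
  ... | tri≈ _ ℓa≡ℓb _ = ℓ-injective ℓa≡ℓb
  ... | tri> _ _ ℓb≺ℓa = ⊥-elim (a≢d (ℓ-injective (≼-antisym (ℓ≼ℓd a)
          (littles-below (ℓ-little b) (ℓ-little a) (sym c≡) ℓb≺ℓa (ℓ-little d)))))

claim8 : (n : ℕ) → 1 ≤ n → {C : Set} → (cls : CrownV n → C)
    → (_≺_ : CrownV n → CrownV n → Set) → IsStrictTotalOrder _≡_ _≺_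
    → Consistent cls _≺_
    → AtLeastClassesWithLittle cls _≺_ (n ∸ 1)
      × (∀ (u w : CrownV n) → Little _≺_ u → Little _≺_ w → u ≢ w → cls u ≡ cls w
          → proj₁ u ≢ proj₁ w)
claim8 (suc m) (s≤s z≤n) {C} cls _≺_ sto consistent =
  (g , g-injective , λ j → ℓ (punchIn d j) , ℓ-little (punchIn d j) , refl)
  , littles-of-a-class-on-opposite-sides
  where
  open CrownOrder cls sto consistent

  d : Fin (suc m)
  d = proj₁ (argmax sto ℓ)

  g : Fin m → C
  g j = cls (ℓ (punchIn d j))

  g-injective : ∀ {i j} → g i ≡ g j → i ≡ j
  g-injective {i} {j} gi≡gj = punchIn-injective d i j
    (cls∘ℓ-injective-off-max (proj₂ (argmax sto ℓ)) (punchInᵢ≢i d i) (punchInᵢ≢i d j) gi≡gj)
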